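{- Let $A$ be a bounded idempotent pseudo-hoop. Then every state-morphism operator on ${\rm Inv}(A)$ can be extended to a state-morphism operator on $A$; that is, for every state-morphism operator $\mu$ on ${\rm Inv}(A)$ there is a state-morphism operator $\nu$ on $A$ whose restriction to ${\rm Inv}(A)$ is $\mu$.
   Context: A pseudo-hoop is an algebra $(A,\odot,\rightarrow,\rightsquigarrow,1)$ of type $(2,2,2,0)$ such that for all $x,y,z\in A$: $x\odot 1=1\odot x=x$; $x\rightarrow x=x\rightsquigarrow x=1$; $(x\odot y)\rightarrow z=x\rightarrow(y\rightarrow z)$; $(x\odot y)\rightsquigarrow z=y\rightsquigarrow(x\rightsquigarrow z)$; $(x\rightarrow y)\odot x=(y\rightarrow x)\odot y=x\odot(x\rightsquigarrow y)=y\odot(y\rightsquigarrow x)$. The order is $x\le y$ iff $x\rightarrow y=1$. It is bounded if it has a least element $0$; then $x^-=x\rightarrow 0$, $x^\sim=x\rightsquigarrow 0$, $x^{ -\sim}=(x^-)^\sim$, $x^{\sim- }=(x^\sim)^-$. It is idempotent if $x\odot x=x$ for all $x$. ${\rm Inv}(A)=\{x\in A\mid x^{ -\sim}=x^{\sim- }=x\}$, regarded as a bounded pseudo-hoop with the operations restricted from $A$ (for bounded idempotent $A$ it contains $0,1$ and is closed under $\odot,\rightarrow,\rightsquigarrow$). A state-morphism operator on a pseudo-hoop $B$ is a map $\mu:B\to B$ with $\mu(x\odot y)=\mu(x)\odot\mu(y)$, $\mu(x\rightarrow y)=\mu(x)\rightarrow\mu(y)$, $\mu(x\rightsquigarrow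 y)=\mu(x)\rightsquigarrow\mu(y)$ for all $x,y$, and $\mu\circ\mu=\mu$. -}

module Defs where

open import Level using (Level; suc; _⊔_)
open import Relation.Binary.PropositionalEquality using (_≡_)
open import Data.Product using (Σ; _×_; proj₁; _,_)

record PseudoHoop (a : Level) : Set (suc a) where
  infixl 7 _⊙_
  infixr 5 _⇒_ _⇝_
  field
    Carrier : Set a
    _⊙_ : Carrier → Carrier → Carrier
    _⇒_ : Carrier → Carrier → Carrier
    _⇝_ : Carrier → Carrier → Carrier
    𝟏   : Carrier
    ⊙-identityʳ : ∀ x → x ⊙ 𝟏 ≡ x
    ⊙-identityˡ : ∀ x → 𝟏 ⊙ x ≡ x
    ⇒-refl : ∀ x → x ⇒ x ≡ 𝟏
    ⇝-refl : ∀ x → x ⇝ x ≡ 𝟏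
    ⇒-curry : ∀ x y z → (x ⊙ y) ⇒ z ≡ x ⇒ (y ⇒ z)
    ⇝-curry : ∀ x y z → (x ⊙ y) ⇝ z ≡ y ⇝ (x ⇝ z)
    divisibility₁ : ∀ x y → (x ⇒ y) ⊙ x ≡ (y ⇒ x) ⊙ y
    divisibility₂ : ∀ x y → (y ⇒ x) ⊙ y ≡ x ⊙ (x ⇝ y)
    divisibility₃ : ∀ x y → x ⊙ (x ⇝ y) ≡ y ⊙ (y ⇝ x)

  _≤_ : Carrier → Carrier → Set a
  x ≤ y = x ⇒ y ≡ 𝟏

  IsIdempotent : Set a
  IsIdempotent = ∀ x → x ⊙ x ≡ x

  IsLeast : Carrier → Set a
  IsLeast z = ∀ x → z ≤ x

  IsStateMorphism : (Carrier → Carrier) → Set a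
  IsStateMorphism ν =
    (∀ x y → ν (x ⊙ y) ≡ ν x ⊙ ν y) ×
    (∀ x y → ν (x ⇒ y) ≡ ν x ⇒ ν y) ×
    (∀ x y → ν (x ⇝ y) ≡ ν x ⇝ ν y) ×
    (∀ x → ν (ν x) ≡ ν x)

record BoundedPseudoHoop (a : Level) : Set (suc a) where
  field
    pseudoHoop : PseudoHoop a
  open PseudoHoop pseudoHoop public
  field
    𝟎 : Carrier
    𝟎-least : IsLeast 𝟎

  _⁻ : Carrier → Carrier
  x ⁻ = x ⇒ 𝟎

  _∼ : Carrier → Carrier
  x ∼ = x ⇝ 𝟎

  IsInv : Carrier → Set a
  IsInv x = ((x ⁻) ∼ ≡ x) × ((x ∼) ⁻ ≡ x)

  Inv : Set a
  Inv = Σ Carrier IsInv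

  -- A state-morphism operator on the pseudo-hoop Inv(A) (operations restricted
  -- from A; equality in Inv(A) is equality of underlying elements).  Since the
  -- closure of Inv(A) under ⊙, →, ⇝ is a fact about A, the law for each operation
  -- is quantified over all membership proofs of the combined element.
  IsInvStateMorphism : (Inv → Inv) → Set a
  IsInvStateMorphism μ =
    (∀ (x y : Inv) (q : IsInv (proj₁ x ⊙ proj₁ y)) →
       proj₁ (μ (proj₁ x ⊙ proj₁ y , q)) ≡ proj₁ (μ x) ⊙ proj₁ (μ y)) ×
    (∀ (x y : Inv) (q : IsInv (proj₁ x ⇒ proj₁ y)) →
       proj₁ (μ (proj₁ x ⇒ proj₁ y , q)) ≡ proj₁ (μ x) ⇒ proj₁ (μ y)) ×
    (∀ (x y : Inv) (q : IsInv (proj₁ x ⇝ proj₁ y)) →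
       proj₁ (μ (proj₁ x ⇝ proj₁ y , q)) ≡ proj₁ (μ x) ⇝ proj₁ (μ y)) ×
    (∀ (x : Inv) → proj₁ (μ (μ x)) ≡ proj₁ (μ x))

module Submission where

-- In an idempotent pseudo-hoop ⊙ is the meet of the order, hence commutative, and
-- → coincides with ⇝; so a bounded idempotent pseudo-hoop is a Heyting-like structure
-- in which, as in Glivenko's theorem, double negation x ↦ x⁻⁻ preserves ⊙, → and ⇝.
-- Its image is exactly Inv(A), on which it is the identity, so it is a homomorphic
-- retraction of A onto Inv(A); composing μ with any such retraction extends μ.

open import Defs
open import Level using (Level)
open import Relation.Binary.PropositionalEquality
open import Data.Product using (Σ; _×_; proj₁; proj₂; _,_)
open import Algebra.Core using (Op₂)
open import Axiom.UniquenessOfIdentityProofs.WithK using (uip)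

module PseudoHoopProperties {a : Level} (H : PseudoHoop a) where
  open PseudoHoop H
  open ≡-Reasoning

  ≤-refl : ∀ {x} → x ≤ x
  ≤-refl {x} = ⇒-refl x

  ≤-factorˡ : ∀ {x y} → x ≤ y → x ≡ (y ⇒ x) ⊙ y
  ≤-factorˡ {x} {y} x≤y = begin
    x            ≡⟨ sym (⊙-identityˡ x) ⟩
    𝟏 ⊙ x        ≡⟨ cong (_⊙ x) (sym x≤y) ⟩
    (x ⇒ y) ⊙ x  ≡⟨ divisibility₁ x y ⟩
    (y ⇒ x) ⊙ y  ∎

  ≤-antisym : ∀ {x y} → x ≤ y → y ≤ x → x ≡ y
  ≤-antisym {x} {y} x≤y y≤x = begin
    x            ≡⟨ ≤-factorˡ x≤y ⟩
    (y ⇒ x) ⊙ y  ≡⟨ cong (_⊙ y) y≤x ⟩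
    𝟏 ⊙ y        ≡⟨ ⊙-identityˡ y ⟩
    y            ∎

  ⇒-absorbs-𝟏⇒ : ∀ x y → x ⇒ (𝟏 ⇒ y) ≡ x ⇒ y
  ⇒-absorbs-𝟏⇒ x y = trans (sym (⇒-curry x 𝟏 y)) (cong (_⇒ y) (⊙-identityʳ x))

  ⇒-identityˡ : ∀ x → 𝟏 ⇒ x ≡ x
  ⇒-identityˡ x = ≤-antisym
    (trans (sym (⇒-absorbs-𝟏⇒ (𝟏 ⇒ x) x)) ≤-refl)
    (trans (⇒-absorbs-𝟏⇒ x x) ≤-refl)

  ⇒-zeroʳ : ∀ x → x ⇒ 𝟏 ≡ 𝟏
  ⇒-zeroʳ x = begin
    x ⇒ 𝟏                  ≡⟨ cong (_⇒ 𝟏) (sym [x⇒𝟏]⊙x≡x) ⟩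
    ((x ⇒ 𝟏) ⊙ x) ⇒ 𝟏      ≡⟨ ⇒-curry (x ⇒ 𝟏) x 𝟏 ⟩
    (x ⇒ 𝟏) ⇒ (x ⇒ 𝟏)      ≡⟨ ⇒-refl (x ⇒ 𝟏) ⟩
    𝟏                      ∎
    where
    [x⇒𝟏]⊙x≡x : (x ⇒ 𝟏) ⊙ x ≡ x
    [x⇒𝟏]⊙x≡x = trans (divisibility₁ x 𝟏)
                   (trans (⊙-identityʳ (𝟏 ⇒ x)) (⇒-identityˡ x))

  ⇝-zeroʳ : ∀ x → x ⇝ 𝟏 ≡ 𝟏
  ⇝-zeroʳ x = begin
    x ⇝ 𝟏                  ≡⟨ cong (_⇝ 𝟏) (sym x⊙[x⇝𝟏]≡x) ⟩
    (x ⊙ (x ⇝ 𝟏)) ⇝ 𝟏      ≡⟨ ⇝-curry x (x ⇝ 𝟏) 𝟏 ⟩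
    (x ⇝ 𝟏) ⇝ (x ⇝ 𝟏)      ≡⟨ ⇝-refl (x ⇝ 𝟏) ⟩
    𝟏                      ∎
    where
    x⊙[x⇝𝟏]≡x : x ⊙ (x ⇝ 𝟏) ≡ x
    x⊙[x⇝𝟏]≡x = trans (sym (divisibility₂ x 𝟏))
                   (trans (⊙-identityʳ (𝟏 ⇒ x)) (⇒-identityˡ x))

  x⊙y≤y : ∀ x y → (x ⊙ y) ≤ y
  x⊙y≤y x y = trans (⇒-curry x y y) (trans (cong (x ⇒_) (⇒-refl y)) (⇒-zeroʳ x))

  x⊙y⇝x≡𝟏 : ∀ x y → (x ⊙ y) ⇝ x ≡ 𝟏
  x⊙y⇝x≡𝟏 x y = trans (⇝-curry x y x) (trans (cong (y ⇝_) (⇝-refl x)) (⇝-zeroʳ y))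

  ≤-trans : ∀ {x y z} → x ≤ y → y ≤ z → x ≤ z
  ≤-trans {x} {y} {z} x≤y y≤z = begin
    x ⇒ z                ≡⟨ cong (_⇒ z) (≤-factorˡ x≤y) ⟩
    ((y ⇒ x) ⊙ y) ⇒ z    ≡⟨ ⇒-curry (y ⇒ x) y z ⟩
    (y ⇒ x) ⇒ (y ⇒ z)    ≡⟨ cong ((y ⇒ x) ⇒_) y≤z ⟩
    (y ⇒ x) ⇒ 𝟏          ≡⟨ ⇒-zeroʳ (y ⇒ x) ⟩
    𝟏                    ∎

  ≤⇒⇝≡𝟏 : ∀ {x y} → x ≤ y → x ⇝ y ≡ 𝟏
  ≤⇒⇝≡𝟏 {x} {y} x≤y = begin
    x ⇝ y                ≡⟨ cong (_⇝ y) (≤-factorˡ x≤y) ⟩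
    ((y ⇒ x) ⊙ y) ⇝ y    ≡⟨ cong (_⇝ y) (trans (divisibility₂ x y) (divisibility₃ x y)) ⟩
    (y ⊙ (y ⇝ x)) ⇝ y    ≡⟨ x⊙y⇝x≡𝟏 y (y ⇝ x) ⟩
    𝟏                    ∎

  ⇝≡𝟏⇒≤ : ∀ {x y} → x ⇝ y ≡ 𝟏 → x ≤ y
  ⇝≡𝟏⇒≤ {x} {y} x⇝y≡𝟏 = begin
    x ⇒ y                ≡⟨ cong (_⇒ y) x≡[y⇒x]⊙y ⟩
    ((y ⇒ x) ⊙ y) ⇒ y    ≡⟨ x⊙y≤y (y ⇒ x) y ⟩
    𝟏                    ∎
    where
    x≡[y⇒x]⊙y : x ≡ (y ⇒ x) ⊙ y
    x≡[y⇒x]⊙y = trans (sym (⊙-identityʳ x))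
                  (trans (cong (x ⊙_) (sym x⇝y≡𝟏)) (sym (divisibility₂ x y)))

  x⊙y≤x : ∀ x y → (x ⊙ y) ≤ x
  x⊙y≤x x y = ⇝≡𝟏⇒≤ (x⊙y⇝x≡𝟏 x y)

  curryˡ : ∀ {x y z} → (x ⊙ y) ≤ z → x ≤ (y ⇒ z)
  curryˡ {x} {y} {z} = trans (sym (⇒-curry x y z))

  uncurryˡ : ∀ {x y z} → x ≤ (y ⇒ z) → (x ⊙ y) ≤ z
  uncurryˡ {x} {y} {z} = trans (⇒-curry x y z)

  curryʳ : ∀ {x y z} → (x ⊙ y) ≤ z → y ≤ (x ⇝ z)
  curryʳ {x} {y} {z} x⊙y≤z = ⇝≡𝟏⇒≤ (trans (sym (⇝-curry x y z)) (≤⇒⇝≡𝟏 x⊙y≤z))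

  uncurryʳ : ∀ {x y z} → y ≤ (x ⇝ z) → (x ⊙ y) ≤ z
  uncurryʳ {x} {y} {z} y≤x⇝z = ⇝≡𝟏⇒≤ (trans (⇝-curry x y z) (≤⇒⇝≡𝟏 y≤x⇝z))

  ⇒-mp : ∀ {x y} → ((x ⇒ y) ⊙ x) ≤ y
  ⇒-mp = uncurryˡ ≤-refl

  ⇝-mp : ∀ {x y} → (x ⊙ (x ⇝ y)) ≤ y
  ⇝-mp = uncurryʳ ≤-refl

  ⊙-monoˡ-≤ : ∀ {x y} z → x ≤ y → (x ⊙ z) ≤ (y ⊙ z)
  ⊙-monoˡ-≤ z x≤y = uncurryˡ (≤-trans x≤y (curryˡ ≤-refl))

  ⊙-monoʳ-≤ : ∀ {x y} z → x ≤ y → (z ⊙ x) ≤ (z ⊙ y)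
  ⊙-monoʳ-≤ z x≤y = uncurryʳ (≤-trans x≤y (curryʳ ≤-refl))

  ⇒-antimonoˡ-≤ : ∀ {x y} z → x ≤ y → (y ⇒ z) ≤ (x ⇒ z)
  ⇒-antimonoˡ-≤ z x≤y = curryˡ (≤-trans (⊙-monoʳ-≤ _ x≤y) ⇒-mp)

module IdempotentPseudoHoopProperties {a : Level} (H : PseudoHoop a)
  (idem : PseudoHoop.IsIdempotent H) where
  open PseudoHoop H
  open PseudoHoopProperties H

  ⊙-greatest : ∀ {x y z} → z ≤ x → z ≤ y → z ≤ (x ⊙ y)
  ⊙-greatest {x} {y} {z} z≤x z≤y =
    subst (_≤ (x ⊙ y)) (idem z) (≤-trans (⊙-monoˡ-≤ z z≤x) (⊙-monoʳ-≤ x z≤y))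

  ⊙-comm : ∀ x y → x ⊙ y ≡ y ⊙ x
  ⊙-comm x y = ≤-antisym (⊙-greatest (x⊙y≤y x y) (x⊙y≤x x y))
                         (⊙-greatest (x⊙y≤y y x) (x⊙y≤x y x))

  ⊙-swap-≤ : ∀ {x y z} → (x ⊙ y) ≤ z → (y ⊙ x) ≤ z
  ⊙-swap-≤ {x} {y} {z} = subst (_≤ z) (⊙-comm x y)

  ⇒≡⇝ : ∀ x y → x ⇒ y ≡ x ⇝ y
  ⇒≡⇝ x y = ≤-antisym (curryʳ (⊙-swap-≤ ⇒-mp)) (curryˡ (⊙-swap-≤ ⇝-mp))

module InvRetraction {a : Level} (A : BoundedPseudoHoop a) where
  open BoundedPseudoHoop A

  record IsInvRetraction (r : Carrier → Carrier) : Set a where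
    field
      isInv : ∀ x → IsInv (r x)
      fixes-Inv : ∀ {x} → IsInv x → r x ≡ x
      ⊙-homo : ∀ x y → r (x ⊙ y) ≡ r x ⊙ r y
      ⇒-homo : ∀ x y → r (x ⇒ y) ≡ r x ⇒ r y
      ⇝-homo : ∀ x y → r (x ⇝ y) ≡ r x ⇝ r y

  IsInv-irrelevant : ∀ {x} (p q : IsInv x) → p ≡ q
  IsInv-irrelevant (p₁ , p₂) (q₁ , q₂) = cong₂ _,_ (uip p₁ q₁) (uip p₂ q₂)

  module Extension {r : Carrier → Carrier} (retraction : IsInvRetraction r)
    (μ : Inv → Inv) (μ-stateMorphism : IsInvStateMorphism μ) where
    open IsInvRetraction retraction

    μ-cong : ∀ {u v} → u ≡ v → (p : IsInv u) (q : IsInv v) →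
             proj₁ (μ (u , p)) ≡ proj₁ (μ (v , q))
    μ-cong refl p q = cong (λ t → proj₁ (μ (_ , t))) (IsInv-irrelevant p q)

    ν : Carrier → Carrier
    ν x = proj₁ (μ (r x , isInv x))

    ν-homo : (_∙_ : Op₂ Carrier) → (∀ x y → r (x ∙ y) ≡ r x ∙ r y) →
             (∀ (u v : Inv) (q : IsInv (proj₁ u ∙ proj₁ v)) →
                proj₁ (μ (proj₁ u ∙ proj₁ v , q)) ≡ proj₁ (μ u) ∙ proj₁ (μ v)) →
             ∀ x y → ν (x ∙ y) ≡ ν x ∙ ν y
    ν-homo _∙_ r-homo μ-homo x y =
      trans (μ-cong (r-homo x y) (isInv (x ∙ y)) q) (μ-homo (r x , isInv x) (r y , isInv y) q)
      where
      q : IsInv (r x ∙ r y)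
      q = subst IsInv (r-homo x y) (isInv (x ∙ y))

    ν-idem : ∀ x → ν (ν x) ≡ ν x
    ν-idem x = trans (μ-cong (fixes-Inv (proj₂ μx)) (isInv (ν x)) (proj₂ μx))
                     (proj₂ (proj₂ (proj₂ μ-stateMorphism)) (r x , isInv x))
      where
      μx : Inv
      μx = μ (r x , isInv x)

    ν-extends-μ : ∀ (x : Inv) → ν (proj₁ x) ≡ proj₁ (μ x)
    ν-extends-μ (x , p) = μ-cong (fixes-Inv p) (isInv x) p

    ν-isStateMorphism : IsStateMorphism ν
    ν-isStateMorphism =
      ν-homo _⊙_ ⊙-homo (proj₁ μ-stateMorphism) ,
      ν-homo _⇒_ ⇒-homo (proj₁ (proj₂ μ-stateMorphism)) ,
      ν-homo _⇝_ ⇝-homo (proj₁ (proj₂ (proj₂ μ-stateMorphism))) ,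
      ν-idem

module BoundedIdempotentPseudoHoopProperties {a : Level} (A : BoundedPseudoHoop a)
  (idem : BoundedPseudoHoop.IsIdempotent A) where
  open BoundedPseudoHoop A
  open PseudoHoopProperties pseudoHoop
  open IdempotentPseudoHoopProperties pseudoHoop idem
  open InvRetraction A using (IsInvRetraction)

  x≤x⁻⁻ : ∀ x → x ≤ (x ⁻ ⁻)
  x≤x⁻⁻ x = curryˡ (⊙-swap-≤ ⇒-mp)

  ⁻-antitone : ∀ {x y} → x ≤ y → (y ⁻) ≤ (x ⁻)
  ⁻-antitone = ⇒-antimonoˡ-≤ 𝟎

  ⁻⁻-monotone : ∀ {x y} → x ≤ y → (x ⁻ ⁻) ≤ (y ⁻ ⁻)
  ⁻⁻-monotone x≤y = ⁻-antitone (⁻-antitone x≤y)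

  x⁻⁻⁻≡x⁻ : ∀ x → x ⁻ ⁻ ⁻ ≡ x ⁻
  x⁻⁻⁻≡x⁻ x = ≤-antisym (⁻-antitone (x≤x⁻⁻ x)) (x≤x⁻⁻ (x ⁻))

  -- Negations are closed under double negation, and y ⇒ w⁻ is the negation (y ⊙ w)⁻.
  ⁻⁻-absorbedˡ : ∀ {x y w} → (x ⊙ y) ≤ (w ⁻) → (x ⁻ ⁻ ⊙ y) ≤ (w ⁻)
  ⁻⁻-absorbedˡ {x} {y} {w} x⊙y≤w⁻ = uncurryˡ (subst ((x ⁻ ⁻) ≤_) [y⊙w]⁻≡y⇒w⁻ x⁻⁻≤[y⊙w]⁻)
    where
    [y⊙w]⁻≡y⇒w⁻ : (y ⊙ w) ⁻ ≡ y ⇒ w ⁻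
    [y⊙w]⁻≡y⇒w⁻ = ⇒-curry y w 𝟎
    x⁻⁻≤[y⊙w]⁻ : (x ⁻ ⁻) ≤ ((y ⊙ w) ⁻)
    x⁻⁻≤[y⊙w]⁻ = subst ((x ⁻ ⁻) ≤_) (x⁻⁻⁻≡x⁻ (y ⊙ w))
                   (⁻⁻-monotone (subst (x ≤_) (sym [y⊙w]⁻≡y⇒w⁻) (curryˡ x⊙y≤w⁻)))

  ⁻⁻-distrib-⊙ : ∀ x y → (x ⊙ y) ⁻ ⁻ ≡ x ⁻ ⁻ ⊙ y ⁻ ⁻
  ⁻⁻-distrib-⊙ x y = ≤-antisym
    (⊙-greatest (⁻⁻-monotone (x⊙y≤x x y)) (⁻⁻-monotone (x⊙y≤y x y)))
    (⊙-swap-≤ (⁻⁻-absorbedˡ (⊙-swap-≤ (⁻⁻-absorbedˡ (x≤x⁻⁻ (x ⊙ y))))))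

  ⁻⁻-distrib-⇒ : ∀ x y → (x ⇒ y) ⁻ ⁻ ≡ x ⁻ ⁻ ⇒ y ⁻ ⁻
  ⁻⁻-distrib-⇒ x y = ≤-antisym
    (curryˡ (subst (_≤ (y ⁻ ⁻)) (⁻⁻-distrib-⊙ (x ⇒ y) x) (⁻⁻-monotone ⇒-mp)))
    (subst (_≤ ((x ⇒ y) ⁻ ⁻)) (⇒-curry (x ⁻ ⁻) (y ⁻) 𝟎)
      (⁻-antitone (⊙-greatest (⁻-antitone x⁻≤x⇒y) (⁻-antitone y≤x⇒y))))
    where
    x⁻≤x⇒y : (x ⁻) ≤ (x ⇒ y)
    x⁻≤x⇒y = curryˡ (≤-trans ⇒-mp (𝟎-least y))
    y≤x⇒y : y ≤ (x ⇒ y)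
    y≤x⇒y = curryˡ (x⊙y≤x y x)

  ⁻⁻-distrib-⇝ : ∀ x y → (x ⇝ y) ⁻ ⁻ ≡ x ⁻ ⁻ ⇝ y ⁻ ⁻
  ⁻⁻-distrib-⇝ x y = begin
    (x ⇝ y) ⁻ ⁻      ≡⟨ cong (λ z → z ⁻ ⁻) (sym (⇒≡⇝ x y)) ⟩
    (x ⇒ y) ⁻ ⁻      ≡⟨ ⁻⁻-distrib-⇒ x y ⟩
    x ⁻ ⁻ ⇒ y ⁻ ⁻    ≡⟨ ⇒≡⇝ (x ⁻ ⁻) (y ⁻ ⁻) ⟩
    x ⁻ ⁻ ⇝ y ⁻ ⁻    ∎
    where open ≡-Reasoning

  x∼≡x⁻ : ∀ x → x ∼ ≡ x ⁻
  x∼≡x⁻ x = sym (⇒≡⇝ x 𝟎)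

  isInv⇒x⁻⁻≡x : ∀ {x} → IsInv x → x ⁻ ⁻ ≡ x
  isInv⇒x⁻⁻≡x {x} (x⁻∼≡x , _) = trans (sym (x∼≡x⁻ (x ⁻))) x⁻∼≡x

  x⁻⁻≡x⇒isInv : ∀ {x} → x ⁻ ⁻ ≡ x → IsInv x
  x⁻⁻≡x⇒isInv {x} x⁻⁻≡x =
    trans (x∼≡x⁻ (x ⁻)) x⁻⁻≡x , trans (cong _⁻ (x∼≡x⁻ x)) x⁻⁻≡x

  ⁻⁻-isInvRetraction : IsInvRetraction (λ x → x ⁻ ⁻)
  ⁻⁻-isInvRetraction = record
    { isInv = λ x → x⁻⁻≡x⇒isInv (cong _⁻ (x⁻⁻⁻≡x⁻ x))
    ; fixes-Inv = isInv⇒x⁻⁻≡x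
    ; ⊙-homo = ⁻⁻-distrib-⊙
    ; ⇒-homo = ⁻⁻-distrib-⇒
    ; ⇝-homo = ⁻⁻-distrib-⇝
    }

corollary6p11 : ∀ {a : Level} (A : BoundedPseudoHoop a) →
    BoundedPseudoHoop.IsIdempotent A →
    (μ : BoundedPseudoHoop.Inv A → BoundedPseudoHoop.Inv A) →
    BoundedPseudoHoop.IsInvStateMorphism A μ →
    Σ (BoundedPseudoHoop.Carrier A → BoundedPseudoHoop.Carrier A) (λ ν →
    BoundedPseudoHoop.IsStateMorphism A ν ×
    (∀ (x : BoundedPseudoHoop.Inv A) → ν (proj₁ x) ≡ proj₁ (μ x)))
corollary6p11 A idem μ μ-stateMorphism = ν , ν-isStateMorphism , ν-extends-μ
  where
  open BoundedIdempotentPseudoHoopProperties A idem using (⁻⁻-isInvRetraction)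
  open InvRetraction.Extension A ⁻⁻-isInvRetraction μ μ-stateMorphism
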